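{- Let $k\geq 0$ and $n\geq k+1$. Then the number of ordered preference sets of length $n$ with exactly $k$ flaws and leading term $a_1=k+1$ is $op_{n,k}^{k+1}=\frac{k+2}{n+1}\binom{2n-k-1}{n-k-1}$.
   Context: Parking model: $n$ parking spaces numbered $1,\dots,n$ from left to right; a preference set of length $n$ is a sequence $(a_1,\dots,a_n)$ with $a_i\in[n]$. Cars arrive in order; car $i$ goes to space $a_i$, and if it is occupied, moves to the first unoccupied space to the right; if there is none, the car cannot park. The number of flaws is the number of cars that cannot park. A preference set is ordered if $a_1\leq\cdots\leq a_n$; its leading term is $a_1$. -}

module Defs where

open import Data.Nat using (ℕ; zero; suc; _+_; _≤ᵇ_; _<ᵇ_)
open import Data.Bool using (Bool; true; false; _∧_; not)
open import Data.Product using (_×_; _,_; proj₁; proj₂)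
open import Data.Fin using (Fin; toℕ)
open import Data.List using (allFin; List; []; _∷_; length; filterᵇ; concatMap; map; replicate)
open import Data.Vec using (Vec; []; _∷_)
import Data.Vec as V

-- A preference set of length n: a sequence (a₁,…,aₙ) with aᵢ ∈ [n] = {1,…,n}.
-- We encode aᵢ by an element x : Fin n, with aᵢ = toℕ x + 1 (see `val`).
PrefSet : ℕ → Set
PrefSet n = Vec (Fin n) n

val : ∀ {n} → Fin n → ℕ
val x = suc (toℕ x)

-- Occupancy of the spaces 1,…,n as a list of flags (true = occupied).
-- parkAt p i occ : occ describes the spaces i, i+1, …; a car with preference
-- p looks at space i only if i ≥ p and takes it if it is free; otherwise it
-- moves right.
parkAt : ℕ → ℕ → List Bool → Bool × List Bool
parkAt p i [] = false , []
parkAt p i (o ∷ os) with (p ≤ᵇ i) ∧ not o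
... | true  = true , (true ∷ os)
... | false with parkAt p (suc i) os
...   | (b , os') = b , (o ∷ os')

flawsFrom : List ℕ → List Bool → ℕ
flawsFrom [] occ = 0
flawsFrom (a ∷ as) occ with parkAt a 1 occ
... | (true  , occ') = flawsFrom as occ'
... | (false , occ') = suc (flawsFrom as occ')

flaws : ∀ {n} → PrefSet n → ℕ
flaws {n} a = flawsFrom (V.toList (V.map val a)) (replicate n false)

orderedᵇ : List ℕ → Bool
orderedᵇ [] = true
orderedᵇ (x ∷ []) = true
orderedᵇ (x ∷ y ∷ xs) = (x ≤ᵇ y) ∧ orderedᵇ (y ∷ xs)

isOrdered : ∀ {n} → PrefSet n → Bool
isOrdered a = orderedᵇ (V.toList (V.map val a))

leadingIsᵇ : ∀ {n m} → ℕ → Vec (Fin n) m → Bool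
leadingIsᵇ c [] = false
leadingIsᵇ c (x ∷ _) = (val x ≤ᵇ c) ∧ (c ≤ᵇ val x)

allVecs : ∀ n m → List (Vec (Fin n) m)
allVecs n zero = [] ∷ []
allVecs n (suc m) = concatMap (λ x → map (x ∷_) (allVecs n m)) (allFin n)

eqᵇ : ℕ → ℕ → Bool
eqᵇ a b = (a ≤ᵇ b) ∧ (b ≤ᵇ a)

op : ℕ → ℕ → ℕ → ℕ
op n k c = length (filterᵇ (λ a → isOrdered a ∧ eqᵇ (flaws a) k ∧ leadingIsᵇ c a) (allVecs n n))

-- Every car prefers a space ≥ k + 1, so spaces 1, …, k stay empty and k flaws among n cars force every space
-- from k + 1 on to be filled. Reading ordered preferences value by value, the state that matters is the
-- number t of occupied and r of free spaces from the current value on. The number of ordered tails of m cars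
-- leaving f of them unparked (flawTails) obeys a Pascal-type recursion, and for f + r = m it is the difference
-- of multiset coefficients ((t + r multichoose m)) − ((r − 1 multichoose m + t + 1)). For m = n, t = 0,
-- r = n − k the absorption identity (j + 1)((s multichoose j + 1)) = s((s + 1 multichoose j)) turns this
-- difference into (k + 2)/(n + 1) · C(2n − k − 1, n − k − 1).

module Submission where

open import Defs
open import Data.Bool using (Bool; true; false; _∧_; not; if_then_else_)
open import Data.Bool.Properties using (∧-assoc; ∧-comm; ∧-zeroʳ; T-≡)
open import Data.Fin using (Fin) renaming (zero to fz; suc to fs)
open import Data.List using (List; []; _∷_; _++_; [_]; _∷ʳ_; length; filterᵇ; map; concatMap; tabulate; replicate)
open import Data.List.Properties using (filter-++; length-++; ++-assoc; length-replicate)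
open import Data.Nat using (ℕ; zero; suc; _+_; _*_; _∸_; _≤ᵇ_; _≤_; _<_; s≤s; z<s)
open import Data.Nat.Combinatorics using (_C_; nCn≡1; nCk+nC[k+1]≡[n+1]C[k+1])
open import Data.Nat.Properties
  using (+-0-commutativeMonoid; +-identityʳ; +-suc; +-comm; +-cancelʳ-≡; *-identityˡ; *-identityʳ; *-zeroʳ;
         *-distribˡ-+; suc-injective; ≤-refl; ≤-reflexive; ≤-trans; ≤-pred; <⇒≱; m≤m+n; m<m+n; m<n⇒m<1+n;
         m+n∸m≡n; m≤n⇒∃[o]m+o≡n; ≤ᵇ-reflects-≤; ≤⇒≤ᵇ)
open import Data.Nat.Tactic.RingSolver using (solve-∀)
open import Algebra.Properties.CommutativeMonoid.Sum +-0-commutativeMonoid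
  using (sum-syntax; sum-cong-≗; sum-replicate-zero)
open import Data.Product using (_,_; map₂)
open import Data.Vec using (Vec; _∷_)
import Data.Vec as V
open import Function using (_∘_; Equivalence)
open import Relation.Binary.PropositionalEquality using (_≡_; refl; sym; trans; cong; cong₂; subst; module ≡-Reasoning)
open import Relation.Nullary using (contradiction)
open import Relation.Nullary.Decidable using (T?)
open import Relation.Nullary.Reflects using (ofʸ)

open ≡-Reasoning

count : {A : Set} → (A → Bool) → List A → ℕ
count p xs = length (filterᵇ p xs)

count-++ : ∀ {A : Set} (p : A → Bool) xs ys → count p (xs ++ ys) ≡ count p xs + count p ys
count-++ p xs ys = trans (cong length (filter-++ (T? ∘ p) xs ys)) (length-++ (filterᵇ p xs))

count-map : ∀ {A B : Set} (p : B → Bool) (g : A → B) xs → count p (map g xs) ≡ count (p ∘ g) xs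
count-map p g [] = refl
count-map p g (x ∷ xs) with p (g x)
... | true  = cong suc (count-map p g xs)
... | false = count-map p g xs

count-cong : ∀ {A : Set} {p q : A → Bool} → (∀ x → p x ≡ q x) → ∀ xs → count p xs ≡ count q xs
count-cong p≗q [] = refl
count-cong {p = p} {q} p≗q (x ∷ xs) with p x | q x | p≗q x
... | true  | .true  | refl = cong suc (count-cong p≗q xs)
... | false | .false | refl = count-cong p≗q xs

count-none : ∀ {A : Set} {p : A → Bool} → (∀ x → p x ≡ false) → ∀ xs → count p xs ≡ 0
count-none p≗false [] = refl
count-none {p = p} p≗false (x ∷ xs) rewrite p≗false x = count-none p≗false xs

count-∧ : ∀ {A : Set} b (p : A → Bool) xs → count (λ x → b ∧ p x) xs ≡ (if b then count p xs else 0)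
count-∧ true  p xs = refl
count-∧ false p xs = count-none (λ _ → refl) xs

count-concatMap-tabulate : ∀ {A B : Set} {n} (p : B → Bool) (g : A → List B) (h : Fin n → A) →
  count p (concatMap g (tabulate h)) ≡ ∑[ i < n ] count p (g (h i))
count-concatMap-tabulate {n = zero}  p g h = refl
count-concatMap-tabulate {n = suc n} p g h =
  trans (count-++ p (g (h fz)) _) (cong (count p (g (h fz)) +_) (count-concatMap-tabulate p g (h ∘ fs)))

count-allVecs-suc : ∀ {n m} (p : Vec (Fin n) (suc m) → Bool) →
  count p (allVecs n (suc m)) ≡ ∑[ x < n ] count (p ∘ (x ∷_)) (allVecs n m)
count-allVecs-suc {n} {m} p =
  trans (count-concatMap-tabulate p (λ x → map (x ∷_) (allVecs n m)) (λ x → x))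
        (sum-cong-≗ {n} (λ x → count-map p (x ∷_) (allVecs n m)))

∑-select : ∀ n (g : ℕ → ℕ) j → j < n →
  ∑[ x < n ] (if eqᵇ (val x) (suc j) then g (val x) else 0) ≡ g (suc j)
∑-select (suc n) g zero    _         = trans (cong (g 1 +_) (sum-replicate-zero n)) (+-identityʳ (g 1))
∑-select (suc n) g (suc j) (s≤s j<n) = ∑-select n (g ∘ suc) j j<n

∑-above-step : ∀ n (g : ℕ → ℕ) j → j < n →
  ∑[ x < n ] (if suc j ≤ᵇ val x then g (val x) else 0)
    ≡ g (suc j) + ∑[ x < n ] (if suc (suc j) ≤ᵇ val x then g (val x) else 0)
∑-above-step (suc n) g zero    _         = refl
∑-above-step (suc n) g (suc j) (s≤s j<n) = ∑-above-step n (g ∘ suc) j j<n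

∑-above-empty : ∀ n (g : ℕ → ℕ) j → n ≤ j → ∑[ x < n ] (if suc j ≤ᵇ val x then g (val x) else 0) ≡ 0
∑-above-empty zero    g j       _         = refl
∑-above-empty (suc n) g (suc j) (s≤s n≤j) = ∑-above-empty n (g ∘ suc) j n≤j

<⇒≤ᵇ≡false : ∀ {m n} → n < m → (m ≤ᵇ n) ≡ false
<⇒≤ᵇ≡false {m} {n} n<m with m ≤ᵇ n | ≤ᵇ-reflects-≤ m n
... | false | _       = refl
... | true  | ofʸ m≤n = contradiction m≤n (<⇒≱ n<m)

≤⇒≤ᵇ≡true : ∀ {m n} → m ≤ n → (m ≤ᵇ n) ≡ true
≤⇒≤ᵇ≡true m≤n = Equivalence.to T-≡ (≤⇒≤ᵇ m≤n)

eqᵇ-suc : ∀ a b → eqᵇ (suc a) (suc b) ≡ eqᵇ a b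
eqᵇ-suc zero    zero    = refl
eqᵇ-suc zero    (suc b) = refl
eqᵇ-suc (suc a) zero    = refl
eqᵇ-suc (suc a) (suc b) = refl

∧-rotate : ∀ a b c → a ∧ (b ∧ c) ≡ c ∧ (a ∧ b)
∧-rotate a b c = trans (sym (∧-assoc a b c)) (∧-comm (a ∧ b) c)

replicate-++-∷ : ∀ {A : Set} t (x : A) xs → replicate t x ++ x ∷ xs ≡ x ∷ replicate t x ++ xs
replicate-++-∷ zero    x xs = refl
replicate-++-∷ (suc t) x xs = cong (x ∷_) (replicate-++-∷ t x xs)

replicate-+ : ∀ {A : Set} a b (x : A) → replicate (a + b) x ≡ replicate a x ++ replicate b x
replicate-+ zero    b x = refl
replicate-+ (suc a) b x = cong (x ∷_) (replicate-+ a b x)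

length-∷ʳ : ∀ {A : Set} (xs : List A) x → length (xs ∷ʳ x) ≡ suc (length xs)
length-∷ʳ xs x = trans (length-++ xs) (+-comm (length xs) 1)

parkAt-pass : ∀ a i o os → ((a ≤ᵇ i) ∧ not o) ≡ false →
  parkAt a i (o ∷ os) ≡ map₂ (o ∷_) (parkAt a (suc i) os)
parkAt-pass a i o os passes rewrite passes = refl

parkAt-before : ∀ a i (L R : List Bool) → i + length L ≤ a →
  parkAt a i (L ++ R) ≡ map₂ (L ++_) (parkAt a (i + length L) R)
parkAt-before a i []      R _ rewrite +-identityʳ i = refl
parkAt-before a i (o ∷ L) R i+L≤a rewrite +-suc i (length L)
  | parkAt-pass a i o (L ++ R) (cong (_∧ not o) (<⇒≤ᵇ≡false (≤-trans (s≤s (m≤m+n i (length L))) i+L≤a)))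
  | parkAt-before a (suc i) L R i+L≤a = refl

parkAt-occupied : ∀ a i t (R : List Bool) →
  parkAt a i (replicate t true ++ R) ≡ map₂ (replicate t true ++_) (parkAt a (i + t) R)
parkAt-occupied a i zero    R rewrite +-identityʳ i = refl
parkAt-occupied a i (suc t) R rewrite +-suc i t
  | parkAt-pass a i true (replicate t true ++ R) (∧-zeroʳ (a ≤ᵇ i))
  | parkAt-occupied a (suc i) t R = refl

parkAt-take : ∀ a i os → a ≤ i → parkAt a i (false ∷ os) ≡ (true , true ∷ os)
parkAt-take a i os a≤i rewrite ≤⇒≤ᵇ≡true a≤i = refl

-- The cells of L lie before the current space suc (length L): no car still to come looks at them.
layout : List Bool → ℕ → ℕ → List Bool
layout L t r = L ++ replicate t true ++ replicate r false

parkAt-layout-free : ∀ L t r → parkAt (suc (length L)) 1 (layout L t (suc r)) ≡ (true , layout L (suc t) r)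
parkAt-layout-free L t r
  rewrite parkAt-before (suc (length L)) 1 L (replicate t true ++ replicate (suc r) false) ≤-refl
        | parkAt-occupied (suc (length L)) (suc (length L)) t (replicate (suc r) false)
        | parkAt-take (suc (length L)) (suc (length L) + t) (replicate r false) (m≤m+n _ t)
        | replicate-++-∷ t true (replicate r false) = refl

parkAt-layout-full : ∀ L t → parkAt (suc (length L)) 1 (layout L t 0) ≡ (false , layout L t 0)
parkAt-layout-full L t
  rewrite parkAt-before (suc (length L)) 1 L (replicate t true ++ []) ≤-refl
        | parkAt-occupied (suc (length L)) (suc (length L)) t [] = refl

flawsFrom-layout-free : ∀ L t r l →
  flawsFrom (suc (length L) ∷ l) (layout L t (suc r)) ≡ flawsFrom l (layout L (suc t) r)
flawsFrom-layout-free L t r l rewrite parkAt-layout-free L t r = refl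

flawsFrom-layout-full : ∀ L t l →
  flawsFrom (suc (length L) ∷ l) (layout L t 0) ≡ suc (flawsFrom l (layout L t 0))
flawsFrom-layout-full L t l rewrite parkAt-layout-full L t = refl

multichoose : ℕ → ℕ → ℕ
multichoose a       zero    = 1
multichoose zero    (suc j) = 0
multichoose (suc a) (suc j) = multichoose (suc a) j + multichoose a (suc j)

multichoose-one-kind : ∀ j → multichoose 1 j ≡ 1
multichoose-one-kind zero    = refl
multichoose-one-kind (suc j) = trans (+-identityʳ _) (multichoose-one-kind j)

multichoose-C : ∀ a j → multichoose (suc a) j ≡ (a + j) C j
multichoose-C a       zero    = refl
multichoose-C zero    (suc j) = trans (multichoose-one-kind (suc j)) (sym (nCn≡1 (suc j)))
multichoose-C (suc a) (suc j) = begin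
  multichoose (suc (suc a)) j + multichoose (suc a) (suc j)
    ≡⟨ cong₂ _+_ (multichoose-C (suc a) j) (multichoose-C a (suc j)) ⟩
  (suc a + j) C j + (a + suc j) C suc j
    ≡⟨ cong (λ x → x C j + (a + suc j) C suc j) (sym (+-suc a j)) ⟩
  (a + suc j) C j + (a + suc j) C suc j
    ≡⟨ nCk+nC[k+1]≡[n+1]C[k+1] (a + suc j) j ⟩
  (suc a + suc j) C suc j ∎

multichoose-sym : ∀ a j → multichoose (suc a) j ≡ multichoose (suc j) a
multichoose-sym zero    j       = multichoose-one-kind j
multichoose-sym (suc a) zero    = sym (multichoose-one-kind (suc a))
multichoose-sym (suc a) (suc j) = begin
  multichoose (suc (suc a)) j + multichoose (suc a) (suc j)
    ≡⟨ cong₂ _+_ (multichoose-sym (suc a) j) (multichoose-sym a (suc j)) ⟩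
  multichoose (suc j) (suc a) + multichoose (suc (suc j)) a
    ≡⟨ +-comm (multichoose (suc j) (suc a)) _ ⟩
  multichoose (suc (suc j)) a + multichoose (suc j) (suc a) ∎

multichoose-singletons : ∀ a → multichoose a 1 ≡ a
multichoose-singletons zero    = refl
multichoose-singletons (suc a) = cong suc (multichoose-singletons a)

multichoose-absorb : ∀ s j → suc j * multichoose s (suc j) ≡ s * multichoose (suc s) j
multichoose-absorb s             zero    = trans (*-identityˡ _) (trans (multichoose-singletons s) (sym (*-identityʳ s)))
multichoose-absorb zero          (suc j) = *-zeroʳ (suc (suc j))
multichoose-absorb (suc zero)    (suc j) = begin
  suc (suc j) * multichoose 1 (suc (suc j)) ≡⟨ cong (suc (suc j) *_) (multichoose-one-kind (suc (suc j))) ⟩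
  suc (suc j) * 1                           ≡⟨ *-identityʳ _ ⟩
  suc (suc j)
    ≡⟨ sym (trans (multichoose-sym 1 (suc j)) (multichoose-singletons (suc (suc j)))) ⟩
  multichoose 2 (suc j)                     ≡⟨ sym (*-identityˡ _) ⟩
  1 * multichoose 2 (suc j)                 ∎
multichoose-absorb (suc (suc b)) (suc j) = begin
  suc (suc j) * (X + multichoose (suc b) (suc (suc j)))
    ≡⟨ *-distribˡ-+ (suc (suc j)) X _ ⟩
  suc (suc j) * X + suc (suc j) * multichoose (suc b) (suc (suc j))
    ≡⟨ cong (suc (suc j) * X +_) (multichoose-absorb (suc b) (suc j)) ⟩
  suc (suc j) * X + suc b * X
    ≡⟨ shift j b X ⟩
  suc j * X + suc (suc b) * X
    ≡⟨ cong (_+ suc (suc b) * X) (multichoose-absorb (suc (suc b)) j) ⟩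
  suc (suc b) * multichoose (suc (suc (suc b))) j + suc (suc b) * X
    ≡⟨ sym (*-distribˡ-+ (suc (suc b)) (multichoose (suc (suc (suc b))) j) X) ⟩
  suc (suc b) * (multichoose (suc (suc (suc b))) j + X) ∎
  where
  X = multichoose (suc (suc b)) (suc j)
  shift : ∀ j b X → suc (suc j) * X + suc b * X ≡ suc j * X + suc (suc b) * X
  shift = solve-∀

-- flawTails m t r f counts the ordered sequences of m preferences, none below the current space, that leave
-- f cars unparked when from the current space on t spaces are occupied and then the last r are free.
-- First summands: the next car prefers the current space; second summands: it prefers a later one.
flawTails : ℕ → ℕ → ℕ → ℕ → ℕ
flawTails zero    t       r       zero    = 1
flawTails zero    t       r       (suc f) = 0
flawTails (suc m) zero    zero    f       = 0
flawTails (suc m) (suc t) zero    zero    = flawTails (suc m) t zero zero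
flawTails (suc m) (suc t) zero    (suc f) = flawTails m (suc t) zero f + flawTails (suc m) t zero (suc f)
flawTails (suc m) zero    (suc r) f       = flawTails m 1 r f + flawTails (suc m) zero r f
flawTails (suc m) (suc t) (suc r) f       = flawTails m (suc (suc t)) r f + flawTails (suc m) t (suc r) f

flawTails-vanish : ∀ m t r f → f + r < m → flawTails m t r f ≡ 0
flawTails-vanish (suc m) zero    zero    f       _ = refl
flawTails-vanish (suc m) (suc t) zero    zero    lt = flawTails-vanish (suc m) t zero zero lt
flawTails-vanish (suc m) (suc t) zero    (suc f) lt =
  cong₂ _+_ (flawTails-vanish m (suc t) zero f (≤-pred lt)) (flawTails-vanish (suc m) t zero (suc f) lt)
flawTails-vanish (suc m) zero    (suc r) f       lt =
  cong₂ _+_ (flawTails-vanish m 1 r f lt′) (flawTails-vanish (suc m) zero r f (m<n⇒m<1+n lt′))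
  where lt′ = ≤-pred (subst (_< suc m) (+-suc f r) lt)
flawTails-vanish (suc m) (suc t) (suc r) f       lt =
  cong₂ _+_ (flawTails-vanish m (suc (suc t)) r f (≤-pred (subst (_< suc m) (+-suc f r) lt)))
            (flawTails-vanish (suc m) t (suc r) f lt)

multichoose-pascal : ∀ r j →
  multichoose r (suc (suc j)) ≡ multichoose r (suc j) + multichoose (r ∸ 1) (suc (suc j))
multichoose-pascal zero    j = refl
multichoose-pascal (suc r) j = refl

flawTails-multichoose : ∀ m t r f → f + r ≡ m →
  flawTails m t r f + multichoose (r ∸ 1) (suc (t + m)) ≡ multichoose (t + r) m
flawTails-multichoose zero    t       zero    zero    _  = refl
flawTails-multichoose (suc m) zero    zero    f       _  = refl
flawTails-multichoose (suc m) (suc t) zero    (suc f) eq = begin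
  (A + B) + 0
    ≡⟨ +-identityʳ (A + B) ⟩
  A + B
    ≡⟨ cong₂ _+_ (trans (sym (+-identityʳ A)) (flawTails-multichoose m (suc t) zero f (suc-injective eq)))
                 (trans (sym (+-identityʳ B)) (flawTails-multichoose (suc m) t zero (suc f) eq)) ⟩
  multichoose (suc t + 0) (suc m) ∎
  where
  A = flawTails m (suc t) zero f
  B = flawTails (suc m) t zero (suc f)
flawTails-multichoose (suc m) zero    (suc r) f       eq = begin
  (A + flawTails (suc m) zero r f) + multichoose r (suc (suc m))
    ≡⟨ cong (λ x → (A + x) + multichoose r (suc (suc m)))
            (flawTails-vanish (suc m) zero r f (≤-reflexive (cong suc eq′))) ⟩
  (A + 0) + multichoose r (suc (suc m))
    ≡⟨ cong (_+ multichoose r (suc (suc m))) (+-identityʳ A) ⟩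
  A + multichoose r (suc (suc m))
    ≡⟨ cong (A +_) (multichoose-pascal r m) ⟩
  A + (multichoose r (suc m) + multichoose (r ∸ 1) (suc (suc m)))
    ≡⟨ x+yz≡xz+y A _ _ ⟩
  (A + multichoose (r ∸ 1) (suc (suc m))) + multichoose r (suc m)
    ≡⟨ cong (_+ multichoose r (suc m)) (flawTails-multichoose m 1 r f eq′) ⟩
  multichoose (suc r) (suc m) ∎
  where
  A = flawTails m 1 r f
  eq′ = suc-injective (trans (sym (+-suc f r)) eq)
  x+yz≡xz+y : ∀ x y z → x + (y + z) ≡ (x + z) + y
  x+yz≡xz+y = solve-∀
flawTails-multichoose (suc m) (suc t) (suc r) f       eq = begin
  (A + B) + multichoose r (suc (suc (t + suc m)))
    ≡⟨ cong ((A + B) +_) (multichoose-pascal r (t + suc m)) ⟩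
  (A + B) + (multichoose r (suc (t + suc m)) + multichoose (r ∸ 1) (suc (suc (t + suc m))))
    ≡⟨ medial A B _ _ ⟩
  (A + multichoose (r ∸ 1) (suc (suc (t + suc m)))) + (B + multichoose r (suc (t + suc m)))
    ≡⟨ cong₂ _+_ (trans (cong (λ x → A + multichoose (r ∸ 1) (suc (suc x))) (+-suc t m))
                        (flawTails-multichoose m (suc (suc t)) r f eq′))
                 (flawTails-multichoose (suc m) t (suc r) f eq) ⟩
  multichoose (suc (suc (t + r))) m + multichoose (t + suc r) (suc m)
    ≡⟨ cong (λ x → multichoose (suc x) m + multichoose (t + suc r) (suc m)) (sym (+-suc t r)) ⟩
  multichoose (suc t + suc r) (suc m) ∎
  where
  A = flawTails m (suc (suc t)) r f
  B = flawTails (suc m) t (suc r) f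
  eq′ = suc-injective (trans (sym (+-suc f r)) eq)
  medial : ∀ a b c d → (a + b) + (c + d) ≡ (a + d) + (b + c)
  medial = solve-∀

module Tails (n : ℕ) where

  vals : ∀ {m} → Vec (Fin n) m → List ℕ
  vals v = V.toList (V.map val v)

  tailᵇ : ℕ → List Bool → ℕ → ∀ {m} → Vec (Fin n) m → Bool
  tailᵇ lo occ f v = orderedᵇ (lo ∷ vals v) ∧ eqᵇ (flawsFrom (vals v) occ) f

  ledTailᵇ : ℕ → List Bool → ℕ → ∀ {m} → Vec (Fin n) m → Bool
  ledTailᵇ lo occ f v = orderedᵇ (lo ∷ vals v) ∧ eqᵇ (flawsFrom (lo ∷ vals v) occ) f

  #tails : ℕ → ℕ → List Bool → ℕ → ℕ
  #tails m lo occ f = count (tailᵇ lo occ f) (allVecs n m)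

  #led : ℕ → ℕ → List Bool → ℕ → ℕ
  #led m lo occ f = count (ledTailᵇ lo occ f) (allVecs n m)

  #tails-suc : ∀ m lo occ f →
    #tails (suc m) lo occ f ≡ ∑[ x < n ] (if lo ≤ᵇ val x then #led m (val x) occ f else 0)
  #tails-suc m lo occ f = trans (count-allVecs-suc {n} {m} _) (sum-cong-≗ {n} λ x →
    trans (count-cong (λ v → ∧-assoc (lo ≤ᵇ val x) _ _) (allVecs n m))
          (count-∧ (lo ≤ᵇ val x) _ (allVecs n m)))

  #tails-step : ∀ m j occ f → j < n →
    #tails (suc m) (suc j) occ f ≡ #led m (suc j) occ f + #tails (suc m) (suc (suc j)) occ f
  #tails-step m j occ f j<n = trans (#tails-suc m (suc j) occ f)
    (trans (∑-above-step n (λ lo → #led m lo occ f) j j<n)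
           (cong (#led m (suc j) occ f +_) (sym (#tails-suc m (suc (suc j)) occ f))))

  #tails-beyond : ∀ m j occ f → n ≤ j → #tails (suc m) (suc j) occ f ≡ 0
  #tails-beyond m j occ f n≤j = trans (#tails-suc m (suc j) occ f) (∑-above-empty n (λ lo → #led m lo occ f) j n≤j)

  #led-layout-free : ∀ m L t r f →
    #led m (suc (length L)) (layout L t (suc r)) f ≡ #tails m (suc (length L)) (layout L (suc t) r) f
  #led-layout-free m L t r f =
    count-cong {p = ledTailᵇ lo (layout L t (suc r)) f} {q = tailᵇ lo (layout L (suc t) r) f}
      (λ v → cong (λ x → orderedᵇ (lo ∷ vals v) ∧ eqᵇ x f) (flawsFrom-layout-free L t r (vals v)))
      (allVecs n m)
    where lo = suc (length L)

  #led-layout-full : ∀ m L t f →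
    #led m (suc (length L)) (layout L t 0) (suc f) ≡ #tails m (suc (length L)) (layout L t 0) f
  #led-layout-full m L t f =
    count-cong {p = ledTailᵇ lo (layout L t 0) (suc f)} {q = tailᵇ lo (layout L t 0) f}
      (λ v → cong (orderedᵇ (lo ∷ vals v) ∧_)
        (trans (cong (λ x → eqᵇ x (suc f)) (flawsFrom-layout-full L t (vals v))) (eqᵇ-suc _ f)))
      (allVecs n m)
    where lo = suc (length L)

  #led-layout-full-zero : ∀ m L t → #led m (suc (length L)) (layout L t 0) 0 ≡ 0
  #led-layout-full-zero m L t =
    count-none {p = ledTailᵇ lo (layout L t 0) 0}
      (λ v → trans (cong (λ x → orderedᵇ (lo ∷ vals v) ∧ eqᵇ x 0) (flawsFrom-layout-full L t (vals v)))
                   (∧-zeroʳ _))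
      (allVecs n m)
    where lo = suc (length L)

  #tails-shift : ∀ m L b rest f →
    #tails m (suc (suc (length L))) (L ++ b ∷ rest) f ≡ #tails m (suc (length (L ∷ʳ b))) ((L ∷ʳ b) ++ rest) f
  #tails-shift m L b rest f =
    cong₂ (λ lo occ → #tails m lo occ f) (cong suc (sym (length-∷ʳ L b))) (sym (++-assoc L [ b ] rest))

  private
    prefix<n : ∀ (L : List Bool) s → length L + suc s ≡ n → length L < n
    prefix<n L s len = subst (length L <_) len (m<m+n (length L) z<s)

    snoc-fits : ∀ (L : List Bool) b s → length L + suc s ≡ n → length (L ∷ʳ b) + s ≡ n
    snoc-fits L b s len = trans (cong (_+ s) (length-∷ʳ L b)) (trans (sym (+-suc (length L) s)) len)

    park-fits : ∀ (L : List Bool) t r → length L + (t + suc r) ≡ n → length L + (suc t + r) ≡ n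
    park-fits L t r len = trans (cong (length L +_) (sym (+-suc t r))) len

    split : ∀ {m occ f a b} L {s} → length L + suc s ≡ n →
      #led m (suc (length L)) occ f ≡ a → #tails (suc m) (suc (suc (length L))) occ f ≡ b →
      #tails (suc m) (suc (length L)) occ f ≡ a + b
    split {m} {occ} {f} L {s} len led≡a tails≡b =
      trans (#tails-step m (length L) occ f (prefix<n L s len)) (cong₂ _+_ led≡a tails≡b)

  #tails-layout : ∀ m t r L f → length L + (t + r) ≡ n →
    #tails m (suc (length L)) (layout L t r) f ≡ flawTails m t r f
  #tails-layout zero    t       r       L zero    _   = refl
  #tails-layout zero    t       r       L (suc f) _   = refl
  #tails-layout (suc m) zero    zero    L f       len =
    #tails-beyond m (length L) (layout L 0 0) f (≤-reflexive (trans (sym len) (+-identityʳ (length L))))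
  #tails-layout (suc m) (suc t) zero    L zero    len = split L len
    (#led-layout-full-zero m L (suc t))
    (trans (#tails-shift (suc m) L true _ zero) (#tails-layout (suc m) t zero (L ∷ʳ true) zero (snoc-fits L true _ len)))
  #tails-layout (suc m) (suc t) zero    L (suc f) len = split L len
    (trans (#led-layout-full m L (suc t) f) (#tails-layout m (suc t) zero L f len))
    (trans (#tails-shift (suc m) L true _ (suc f))
           (#tails-layout (suc m) t zero (L ∷ʳ true) (suc f) (snoc-fits L true _ len)))
  #tails-layout (suc m) zero    (suc r) L f       len = split L len
    (trans (#led-layout-free m L 0 r f) (#tails-layout m 1 r L f (park-fits L 0 r len)))
    (trans (#tails-shift (suc m) L false _ f) (#tails-layout (suc m) zero r (L ∷ʳ false) f (snoc-fits L false _ len)))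
  #tails-layout (suc m) (suc t) (suc r) L f       len = split L len
    (trans (#led-layout-free m L (suc t) r f) (#tails-layout m (suc (suc t)) r L f (park-fits L (suc t) r len)))
    (trans (#tails-shift (suc m) L true _ f) (#tails-layout (suc m) t (suc r) (L ∷ʳ true) f (snoc-fits L true _ len)))

op-leading : ∀ m k → k < suc m → op (suc m) k (suc k) ≡ Tails.#led (suc m) m (suc k) (replicate (suc m) false) k
op-leading m k k<n = begin
  op n k (suc k)
    ≡⟨ count-allVecs-suc {n} {m} _ ⟩
  ∑[ x < n ] count (λ v → isOrdered (x ∷ v) ∧ eqᵇ (flaws (x ∷ v)) k ∧ leadingIsᵇ (suc k) (x ∷ v))
                   (allVecs n m)
    ≡⟨ sum-cong-≗ {n} (λ x → trans
         (count-cong (λ v → ∧-rotate (isOrdered (x ∷ v)) (eqᵇ (flaws (x ∷ v)) k) (eqᵇ (val x) (suc k)))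
                     (allVecs n m))
         (count-∧ (eqᵇ (val x) (suc k)) _ (allVecs n m))) ⟩
  ∑[ x < n ] (if eqᵇ (val x) (suc k) then #led m (val x) occ k else 0)
    ≡⟨ ∑-select n (λ lo → #led m lo occ k) k k<n ⟩
  #led m (suc k) occ k ∎
  where
  n = suc m
  occ = replicate n false
  open Tails n

op-flawTails : ∀ k o → op (suc (k + o)) k (suc k) ≡ flawTails (suc (k + o)) 0 (suc o) k
op-flawTails k o = begin
  op n k (suc k)
    ≡⟨ op-leading m k (s≤s (m≤m+n k o)) ⟩
  #led m (suc k) (replicate n false) k
    ≡⟨ cong₂ (λ lo occ → #led m lo occ k) (cong suc (sym (length-replicate k))) empty ⟩
  #led m (suc (length L)) (layout L 0 (suc o)) k
    ≡⟨ #led-layout-free m L 0 o k ⟩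
  #tails m (suc (length L)) (layout L 1 o) k
    ≡⟨ #tails-layout m 1 o L k (trans (cong (_+ suc o) (length-replicate k)) (+-suc k o)) ⟩
  flawTails m 1 o k
    ≡⟨ sym (+-identityʳ _) ⟩
  flawTails m 1 o k + 0
    ≡⟨ cong (flawTails m 1 o k +_) (sym (flawTails-vanish n 0 o k ≤-refl)) ⟩
  flawTails n 0 (suc o) k ∎
  where
  m = k + o
  n = suc m
  L = replicate k false
  empty : replicate n false ≡ layout L 0 (suc o)
  empty = trans (cong (λ x → replicate x false) (sym (+-suc k o))) (replicate-+ k (suc o) false)
  open Tails n

scaled-difference : ∀ k o h y x → h + y ≡ x → suc (suc (k + o)) * y ≡ o * x →
  (suc (k + o) + 1) * h ≡ (k + 2) * x
scaled-difference k o h y x h+y≡x scale = +-cancelʳ-≡ (o * x) _ _ (begin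
  (suc (k + o) + 1) * h + o * x                 ≡⟨ cong ((suc (k + o) + 1) * h +_) (sym scale) ⟩
  (suc (k + o) + 1) * h + suc (suc (k + o)) * y ≡⟨ factor k o h y ⟩
  suc (suc (k + o)) * (h + y)                   ≡⟨ cong (suc (suc (k + o)) *_) h+y≡x ⟩
  suc (suc (k + o)) * x                         ≡⟨ split k o x ⟩
  (k + 2) * x + o * x                           ∎)
  where
  factor : ∀ k o h y → (suc (k + o) + 1) * h + suc (suc (k + o)) * y ≡ suc (suc (k + o)) * (h + y)
  factor = solve-∀
  split : ∀ k o x → suc (suc (k + o)) * x ≡ (k + 2) * x + o * x
  split = solve-∀

multichoose-leading : ∀ k o →
  multichoose (suc o) (suc (k + o)) ≡ (2 * suc (k + o) ∸ k ∸ 1) C (suc (k + o) ∸ k ∸ 1)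
multichoose-leading k o = begin
  multichoose (suc o) n         ≡⟨ multichoose-sym o n ⟩
  multichoose (suc n) o         ≡⟨ multichoose-C n o ⟩
  (n + o) C o                   ≡⟨ cong₂ _C_ (sym top) (sym bottom) ⟩
  (2 * n ∸ k ∸ 1) C (n ∸ k ∸ 1) ∎
  where
  n = suc (k + o)
  top : 2 * n ∸ k ∸ 1 ≡ n + o
  top = trans (cong (λ x → x ∸ k ∸ 1) (double k o)) (cong (_∸ 1) (m+n∸m≡n k (suc (n + o))))
    where
    double : ∀ k o → 2 * suc (k + o) ≡ k + suc (suc (k + o) + o)
    double = solve-∀
  bottom : n ∸ k ∸ 1 ≡ o
  bottom = cong (_∸ 1) (trans (cong (_∸ k) (sym (+-suc k o))) (m+n∸m≡n k (suc o)))

mainTheorem5 : (k n : ℕ) → k + 1 ≤ n →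
    (n + 1) * op n k (k + 1) ≡ (k + 2) * ((2 * n ∸ k ∸ 1) C (n ∸ k ∸ 1))
mainTheorem5 k n k+1≤n with o , refl ← m≤n⇒∃[o]m+o≡n (subst (_≤ n) (+-comm k 1) k+1≤n) = begin
  (N + 1) * op N k (k + 1)        ≡⟨ cong (λ c → (N + 1) * op N k c) (+-comm k 1) ⟩
  (N + 1) * op N k (suc k)        ≡⟨ cong ((N + 1) *_) (op-flawTails k o) ⟩
  (N + 1) * flawTails N 0 (suc o) k
    ≡⟨ scaled-difference k o _ _ _ (flawTails-multichoose N 0 (suc o) k (+-suc k o)) (multichoose-absorb o N) ⟩
  (k + 2) * multichoose (suc o) N ≡⟨ cong ((k + 2) *_) (multichoose-leading k o) ⟩
  (k + 2) * ((2 * N ∸ k ∸ 1) C (N ∸ k ∸ 1)) ∎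
  where N = suc (k + o)
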